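{- Let $A$ be an MV-algebra with lattice spectrum $X$ and let $J$ be an MV-ideal of $A$. Then the Priestley dual space of the underlying lattice of the quotient MV-algebra $A/J$ is isomorphic (as an ordered topological space) to the $\tau^p$-closed subspace $S_J:=\{x\in X: I_x\,\overline{\oplus}\,J\subseteq I_x\}$ of $(X,\tau^p,\le)$. Moreover, if $J=I_y$ for some $y\in Y$, then $S_{I_y}=\{x\in X: x+y\text{ is defined and }x+y\le x\}$, and $S_{I_y}$ is totally ordered by $\le$.
   Context: MV-algebra $(A,\oplus,\neg,0)$: $(A,\oplus,0)$ commutative monoid, $\neg\neg x=x$, $x\oplus\neg0=\neg0$, $\neg(\neg x\oplus y)\oplus y=\neg(\neg y\oplus x)\oplus x$; $1:=\neg0$, $x\ominus y:=\neg(\neg x\oplus y)$; lattice operations $x\vee y:=\neg(\neg x\oplus y)\oplus y$, $x\wedge y:=\neg(\neg x\vee\neg y)$. MV-ideal: downset containing $0$ closed under $\oplus$; prime if proper and for all $a,b$, $a\ominus b$ or $b\ominus a$ lies in it; $A/J$ is the quotient by the congruence associated with $J$. The Priestley dual space of a bounded distributive lattice $D$: set of its prime lattice ideals, ordered by inclusion, with the topology generated by the sets $\{P: d\notin P\}$ and their complements. $X$ is the Priestley dual space of the lattice reduct of $A$, written $(X,\tau^p,\le)$, with $I_x$ the ideal of $x$. $Y\subseteq X$: points whose ideals are prime MV-ideals. $I\,\overline{\oplus}\,J:=\{c:\exists a\in I,b\in J,\ c\le a\oplus b\}$. For $x,x'\in X$ with $1\notin I_x\,\overline{\oplus}\,I_{x'}$,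 $x+x'$ is the point with $I_{x+x'}=I_x\,\overline{\oplus}\,I_{x'}$ (a prime lattice ideal); otherwise $x+x'$ is undefined. -}

module Defs where

open import Level using (Level; _⊔_) renaming (suc to lsuc)
open import Data.Product using (Σ; _×_; _,_; proj₁; proj₂)
open import Data.Sum using (_⊎_)
open import Data.List using (List)
open import Data.List.Relation.Unary.All using (All)
open import Data.Bool using (Bool; true; false)
open import Relation.Nullary using (¬_)
open import Relation.Unary using (Pred; _∈_; _⊆_)
open import Relation.Binary.PropositionalEquality using (_≡_)

record MVAlgebra (a : Level) : Set (lsuc a) where
  infixl 6 _⊕_
  infix 8 ∼_
  field
    Carrier     : Set a
    _⊕_         : Carrier → Carrier → Carrier
    ∼_          : Carrier → Carrier
    𝟘           : Carrier
    ⊕-assoc     : ∀ x y z → (x ⊕ y) ⊕ z ≡ x ⊕ (y ⊕ z)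
    ⊕-comm      : ∀ x y → x ⊕ y ≡ y ⊕ x
    ⊕-identityʳ : ∀ x → x ⊕ 𝟘 ≡ x
    ∼-involutive : ∀ x → ∼ ∼ x ≡ x
    ⊕-absorbʳ   : ∀ x → x ⊕ ∼ 𝟘 ≡ ∼ 𝟘
    łukasiewicz : ∀ x y → ∼ (∼ x ⊕ y) ⊕ y ≡ ∼ (∼ y ⊕ x) ⊕ x

  𝟙 : Carrier
  𝟙 = ∼ 𝟘

  infixl 6 _⊖_
  _⊖_ : Carrier → Carrier → Carrier
  x ⊖ y = ∼ (∼ x ⊕ y)

  infixl 5 _∨_
  _∨_ : Carrier → Carrier → Carrier
  x ∨ y = ∼ (∼ x ⊕ y) ⊕ y

  infixl 5 _∧_
  _∧_ : Carrier → Carrier → Carrier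
  x ∧ y = ∼ (∼ x ∨ ∼ y)

  infix 4 _≤_
  _≤_ : Carrier → Carrier → Set a
  x ≤ y = x ∨ y ≡ y

  dist : Carrier → Carrier → Carrier
  dist x y = (x ⊖ y) ⊕ (y ⊖ x)

module _ {a : Level} (A : MVAlgebra a) where
  open MVAlgebra A

  record IsMVIdeal (J : Pred Carrier a) : Set a where
    field
      𝟘∈      : 𝟘 ∈ J
      downset : ∀ x y → x ≤ y → y ∈ J → x ∈ J
      ⊕-closed : ∀ x y → x ∈ J → y ∈ J → (x ⊕ y) ∈ J

  record IsPrimeMVIdeal (J : Pred Carrier a) : Set a where
    field
      isMVIdeal : IsMVIdeal J
      proper    : Σ Carrier (λ x → ¬ (x ∈ J))
      prime     : ∀ x y → (x ⊖ y) ∈ J ⊎ (y ⊖ x) ∈ J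

  _⊕̄_ : Pred Carrier a → Pred Carrier a → Pred Carrier a
  (I ⊕̄ J) c = Σ Carrier λ x → Σ Carrier λ y → x ∈ I × y ∈ J × c ≤ x ⊕ y

-- Bounded lattice data presented on a setoid-like carrier (the lattice
-- reduct of A uses ≡; the reduct of A/J uses the congruence θ_J).

record LatticeData (a : Level) : Set (lsuc a) where
  field
    Carrier : Set a
    _≈_     : Carrier → Carrier → Set a
    _∨_     : Carrier → Carrier → Carrier
    _∧_     : Carrier → Carrier → Carrier
    ⊥       : Carrier
    ⊤       : Carrier

  _≤_ : Carrier → Carrier → Set a
  x ≤ y = (x ∨ y) ≈ y

-- prime lattice ideals (subsets of the quotient carrier = predicates
-- respecting ≈)
record IsPrimeLatticeIdeal {a : Level} (L : LatticeData a)
                           (P : Pred (LatticeData.Carrier L) a) : Set a where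
  open LatticeData L
  field
    respects : ∀ x y → x ≈ y → x ∈ P → y ∈ P
    ⊥∈       : ⊥ ∈ P
    downset  : ∀ x y → x ≤ y → y ∈ P → x ∈ P
    ∨-closed : ∀ x y → x ∈ P → y ∈ P → (x ∨ y) ∈ P
    proper   : Σ Carrier (λ x → ¬ (x ∈ P))
    prime    : ∀ x y → (x ∧ y) ∈ P → x ∈ P ⊎ y ∈ P

-- Points of the Priestley dual space: prime lattice ideals.
Point : {a : Level} → LatticeData a → Set (lsuc a)
Point {a} L = Σ (Pred (LatticeData.Carrier L) a) (IsPrimeLatticeIdeal L)

module _ {a : Level} {L : LatticeData a} where
  I : Point L → Pred (LatticeData.Carrier L) a
  I = proj₁

  _≤ₚ_ : Point L → Point L → Set a
  x ≤ₚ y = I x ⊆ I y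

  _≈ₚ_ : Point L → Point L → Set a
  x ≈ₚ y = (I x ⊆ I y) × (I y ⊆ I x)

-- Subbasic sets of τ^p: (d , true) stands for {P : d ∉ P},
-- (d , false) for its complement {P : d ∈ P}.
Holds : {a : Level} (L : LatticeData a) → LatticeData.Carrier L × Bool → Point L → Set a
Holds L (d , true)  x = ¬ (d ∈ I x)
Holds L (d , false) x = d ∈ I x

-- Open sets of the topology generated by the subbasis: every point of O
-- lies in a finite intersection of subbasic sets contained in O.
IsOpen : {a ℓ : Level} (L : LatticeData a) → Pred (Point L) ℓ → Set (lsuc a ⊔ ℓ)
IsOpen L O = ∀ x → O x →
  Σ (List (LatticeData.Carrier L × Bool)) λ ds →
    All (λ s → Holds L s x) ds × (∀ z → All (λ s → Holds L s z) ds → O z)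

IsClosed : {a ℓ : Level} (L : LatticeData a) → Pred (Point L) ℓ → Set (lsuc a ⊔ ℓ)
IsClosed L S = IsOpen L (λ x → ¬ S x)

SubPoint : {a ℓ : Level} (L : LatticeData a) → Pred (Point L) ℓ → Set (lsuc a ⊔ ℓ)
SubPoint L S = Σ (Point L) S

IsOpenSub : {a ℓ ℓ' : Level} (L : LatticeData a) (S : Pred (Point L) ℓ) →
            Pred (SubPoint L S) ℓ' → Set (lsuc a ⊔ ℓ ⊔ lsuc ℓ')
IsOpenSub {ℓ' = ℓ'} L S O =
  Σ (Pred (Point L) ℓ') λ O' → IsOpen L O' ×
    (∀ p → (O p → O' (proj₁ p)) × (O' (proj₁ p) → O p))

-- Open sets are taken as predicates of level lsuc a (the level of points).
record OrderHomeo {a ℓ : Level} (L M : LatticeData a) (S : Pred (Point M) ℓ)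
                  : Set (lsuc (lsuc a) ⊔ ℓ) where
  field
    to      : Point L → SubPoint M S
    from    : SubPoint M S → Point L
    to-cong   : ∀ x y → x ≈ₚ y → proj₁ (to x) ≈ₚ proj₁ (to y)
    from-cong : ∀ p q → proj₁ p ≈ₚ proj₁ q → from p ≈ₚ from q
    from-to : ∀ x → from (to x) ≈ₚ x
    to-from : ∀ p → proj₁ (to (from p)) ≈ₚ proj₁ p
    to-mono    : ∀ x y → x ≤ₚ y → proj₁ (to x) ≤ₚ proj₁ (to y)
    to-reflect : ∀ x y → proj₁ (to x) ≤ₚ proj₁ (to y) → x ≤ₚ y
    to-continuous   : ∀ (O : Pred (SubPoint M S) (lsuc a)) →
                      IsOpenSub M S O → IsOpen L (λ x → O (to x))
    from-continuous : ∀ (O : Pred (Point L) (lsuc a)) →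
                      IsOpen L O → IsOpenSub M S (λ p → O (from p))

LatticeReduct : {a : Level} → MVAlgebra a → LatticeData a
LatticeReduct A = record
  { Carrier = Carrier ; _≈_ = _≡_ ; _∨_ = _∨_ ; _∧_ = _∧_ ; ⊥ = 𝟘 ; ⊤ = 𝟙 }
  where open MVAlgebra A

-- A/J: same carrier, equality the congruence θ_J (x θ_J y iff d(x,y) ∈ J),
-- with the induced lattice operations.
QuotientLattice : {a : Level} (A : MVAlgebra a) → Pred (MVAlgebra.Carrier A) a → LatticeData a
QuotientLattice A J = record
  { Carrier = Carrier ; _≈_ = λ x y → dist x y ∈ J
  ; _∨_ = _∨_ ; _∧_ = _∧_ ; ⊥ = 𝟘 ; ⊤ = 𝟙 }
  where open MVAlgebra A

Spectrum : {a : Level} → MVAlgebra a → Set (lsuc a)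
Spectrum A = Point (LatticeReduct A)

S : {a : Level} (A : MVAlgebra a) → Pred (MVAlgebra.Carrier A) a → Pred (Spectrum A) a
S A J x = _⊕̄_ A (I x) J ⊆ I x

-- x + y is defined iff 1 ∉ I_x ⊕̄ I_y, and then I_{x+y} = I_x ⊕̄ I_y.
PlusDefined : {a : Level} (A : MVAlgebra a) → Spectrum A → Spectrum A → Set a
PlusDefined A x y = ¬ (MVAlgebra.𝟙 A ∈ _⊕̄_ A (I x) (I y))

-- x + y ≤ x  (for defined x + y):  I_{x+y} ⊆ I_x
PlusLe : {a : Level} (A : MVAlgebra a) → Spectrum A → Spectrum A → Set a
PlusLe A x y = _⊕̄_ A (I x) (I y) ⊆ I x

-- A prime lattice ideal P of A is an ideal of the lattice reduct of A/J exactly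
-- when it is saturated for the congruence θ_J, and saturation is P ⊕̄ J ⊆ P:
-- if d(u,v) ∈ J and u ∈ P then v ≤ u ⊕ d(u,v) ∈ P ⊕̄ J, and conversely
-- a ⊕ b θ_J a for b ∈ J. Since both spaces consist of the same ideals with the
-- same subbasic sets, the correspondence is the identity on ideals.
-- S_J is closed: a witness c ≤ a ⊕ b of P ⊕̄ J ⊈ P gives the neighbourhood
-- {Q : a ∈ Q, a ⊕ b ∉ Q} missing S_J.
-- For J = I_y prime, any c ∈ I_x ∖ I_x′ forces I_x′ ⊆ I_x: for d ∈ I_x′ one of
-- c ⊖ d, d ⊖ c lies in I_y, and c ≤ d ⊕ (c ⊖ d), d ≤ c ⊕ (d ⊖ c).
module Submission where

open import Defs
open import Level using (Level; lift; lower) renaming (suc to lsuc)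
open import Data.Product using (_×_; Σ; _,_; proj₁; proj₂)
open import Data.Sum using (_⊎_; inj₁; inj₂)
open import Data.Bool using (true; false)
open import Data.List using (List; []; _∷_)
open import Data.List.Relation.Unary.All as All using (All; []; _∷_)
open import Relation.Unary using (Pred; _∈_; _⊆_)
open import Relation.Nullary using (¬_; yes; no; contradiction)
open import Relation.Nullary.Decidable using (map′; decidable-stable)
open import Relation.Binary.PropositionalEquality
open import Function.Bundles using (_⇔_; mk⇔)
open import Axiom.ExcludedMiddle using (ExcludedMiddle)

lowerExcludedMiddle : ∀ {a} → ExcludedMiddle (lsuc a) → ExcludedMiddle a
lowerExcludedMiddle em = map′ lower lift em

¬⊆⇒∃∉ : ∀ {a} {C : Set a} → ExcludedMiddle a → {P R : Pred C a} →
        ¬ (P ⊆ R) → Σ C λ c → P c × ¬ R c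
¬⊆⇒∃∉ em P⊈R =
  decidable-stable em λ ∄c → P⊈R λ c∈P → decidable-stable em λ c∉R → ∄c (_ , c∈P , c∉R)

module MVProperties {a : Level} (A : MVAlgebra a) where
  open MVAlgebra A
  open ≡-Reasoning

  ∼𝟙≡𝟘 : ∼ 𝟙 ≡ 𝟘
  ∼𝟙≡𝟘 = ∼-involutive 𝟘

  ⊕-identityˡ : ∀ x → 𝟘 ⊕ x ≡ x
  ⊕-identityˡ x = trans (⊕-comm 𝟘 x) (⊕-identityʳ x)

  ⊕-absorbˡ : ∀ x → 𝟙 ⊕ x ≡ 𝟙
  ⊕-absorbˡ x = trans (⊕-comm 𝟙 x) (⊕-absorbʳ x)

  ⊕-inverseˡ : ∀ x → ∼ x ⊕ x ≡ 𝟙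
  ⊕-inverseˡ x = begin
    ∼ x ⊕ x          ≡⟨ cong (λ t → ∼ t ⊕ x) (sym (⊕-identityˡ x)) ⟩
    ∼ (𝟘 ⊕ x) ⊕ x    ≡⟨ cong (λ t → ∼ (t ⊕ x) ⊕ x) (sym ∼𝟙≡𝟘) ⟩
    ∼ (∼ 𝟙 ⊕ x) ⊕ x  ≡⟨ sym (łukasiewicz x 𝟙) ⟩
    ∼ (∼ x ⊕ 𝟙) ⊕ 𝟙  ≡⟨ ⊕-absorbʳ _ ⟩
    𝟙                ∎

  ⊕-inverseʳ : ∀ x → x ⊕ ∼ x ≡ 𝟙
  ⊕-inverseʳ x = trans (⊕-comm x (∼ x)) (⊕-inverseˡ x)

  ∼x⊕y≡𝟙⇒x≤y : ∀ x y → ∼ x ⊕ y ≡ 𝟙 → x ≤ y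
  ∼x⊕y≡𝟙⇒x≤y x y eq = begin
    ∼ (∼ x ⊕ y) ⊕ y ≡⟨ cong (λ t → ∼ t ⊕ y) eq ⟩
    ∼ 𝟙 ⊕ y         ≡⟨ cong (_⊕ y) ∼𝟙≡𝟘 ⟩
    𝟘 ⊕ y           ≡⟨ ⊕-identityˡ y ⟩
    y               ∎

  ≤-refl : ∀ x → x ≤ x
  ≤-refl x = ∼x⊕y≡𝟙⇒x≤y x x (⊕-inverseˡ x)

  ≤-𝟙 : ∀ x → x ≤ 𝟙
  ≤-𝟙 x = ∼x⊕y≡𝟙⇒x≤y x 𝟙 (⊕-absorbʳ (∼ x))

  x≤x∨y : ∀ x y → x ≤ x ∨ y
  x≤x∨y x y = ∼x⊕y≡𝟙⇒x≤y x (x ∨ y) (begin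
    ∼ x ⊕ (∼ u ⊕ y) ≡⟨ cong (∼ x ⊕_) (⊕-comm (∼ u) y) ⟩
    ∼ x ⊕ (y ⊕ ∼ u) ≡⟨ sym (⊕-assoc (∼ x) y (∼ u)) ⟩
    u ⊕ ∼ u         ≡⟨ ⊕-inverseʳ u ⟩
    𝟙               ∎)
    where u = ∼ x ⊕ y

  x≤y⊕[x⊖y] : ∀ x y → x ≤ y ⊕ (x ⊖ y)
  x≤y⊕[x⊖y] x y = subst (x ≤_) (⊕-comm (x ⊖ y) y) (x≤x∨y x y)

  [x⊕y]⊖x≤y : ∀ x y → (x ⊕ y) ⊖ x ≤ y
  [x⊕y]⊖x≤y x y = ∼x⊕y≡𝟙⇒x≤y ((x ⊕ y) ⊖ x) y (begin
    ∼ ∼ (∼ (x ⊕ y) ⊕ x) ⊕ y ≡⟨ cong (_⊕ y) (∼-involutive _) ⟩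
    ∼ (x ⊕ y) ⊕ x ⊕ y       ≡⟨ ⊕-assoc (∼ (x ⊕ y)) x y ⟩
    ∼ (x ⊕ y) ⊕ (x ⊕ y)     ≡⟨ ⊕-inverseˡ (x ⊕ y) ⟩
    𝟙                       ∎)

  x⊖[x⊕y]≡𝟘 : ∀ x y → x ⊖ (x ⊕ y) ≡ 𝟘
  x⊖[x⊕y]≡𝟘 x y = begin
    ∼ (∼ x ⊕ (x ⊕ y)) ≡⟨ cong ∼_ (sym (⊕-assoc (∼ x) x y)) ⟩
    ∼ (∼ x ⊕ x ⊕ y)   ≡⟨ cong (λ t → ∼ (t ⊕ y)) (⊕-inverseˡ x) ⟩
    ∼ (𝟙 ⊕ y)         ≡⟨ cong ∼_ (⊕-absorbˡ y) ⟩
    ∼ 𝟙               ≡⟨ ∼𝟙≡𝟘 ⟩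
    𝟘                 ∎

  dist-comm : ∀ x y → dist x y ≡ dist y x
  dist-comm x y = ⊕-comm (x ⊖ y) (y ⊖ x)

  dist-self : ∀ x → dist x x ≡ 𝟘
  dist-self x = begin
    (x ⊖ x) ⊕ (x ⊖ x) ≡⟨ cong (λ t → t ⊕ t) (cong ∼_ (⊕-inverseˡ x)) ⟩
    ∼ 𝟙 ⊕ ∼ 𝟙         ≡⟨ cong (λ t → t ⊕ t) ∼𝟙≡𝟘 ⟩
    𝟘 ⊕ 𝟘             ≡⟨ ⊕-identityʳ 𝟘 ⟩
    𝟘                 ∎

  dist-x-[x⊕y] : ∀ x y → dist x (x ⊕ y) ≡ (x ⊕ y) ⊖ x
  dist-x-[x⊕y] x y = trans (cong (_⊕ ((x ⊕ y) ⊖ x)) (x⊖[x⊕y]≡𝟘 x y)) (⊕-identityˡ _)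

  y≤x⊕dist : ∀ x y → y ≤ x ⊕ dist x y
  y≤x⊕dist x y = ∼x⊕y≡𝟙⇒x≤y y (x ⊕ dist x y) (begin
    ∼ y ⊕ (x ⊕ ((x ⊖ y) ⊕ ∼ u)) ≡⟨ sym (⊕-assoc (∼ y) x _) ⟩
    u ⊕ ((x ⊖ y) ⊕ ∼ u)         ≡⟨ cong (u ⊕_) (⊕-comm (x ⊖ y) (∼ u)) ⟩
    u ⊕ (∼ u ⊕ (x ⊖ y))         ≡⟨ sym (⊕-assoc u (∼ u) (x ⊖ y)) ⟩
    u ⊕ ∼ u ⊕ (x ⊖ y)           ≡⟨ cong (_⊕ (x ⊖ y)) (⊕-inverseʳ u) ⟩
    𝟙 ⊕ (x ⊖ y)                 ≡⟨ ⊕-absorbˡ (x ⊖ y) ⟩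
    𝟙                           ∎)
    where u = ∼ y ⊕ x

module SpectrumProperties {a : Level} (A : MVAlgebra a) where
  open MVAlgebra A
  open MVProperties A

  𝟙∉I : (x : Spectrum A) → ¬ 𝟙 ∈ I x
  𝟙∉I (P , isP) 𝟙∈P = z∉P (downset z 𝟙 (≤-𝟙 z) 𝟙∈P)
    where
    open IsPrimeLatticeIdeal isP
    z = proj₁ proper
    z∉P = proj₂ proper

  S⇒PlusDefined : ∀ x y → S A (I y) x → PlusDefined A x y
  S⇒PlusDefined x y x∈S 𝟙∈Ix⊕̄Iy = 𝟙∉I x (x∈S 𝟙∈Ix⊕̄Iy)

  S⇔PlusDefined×PlusLe : ∀ x y → S A (I y) x ⇔ (PlusDefined A x y × PlusLe A x y)
  S⇔PlusDefined×PlusLe x y = mk⇔ S⇒PlusDefined×PlusLe proj₂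
    where
    S⇒PlusDefined×PlusLe : S A (I y) x → PlusDefined A x y × PlusLe A x y
    S⇒PlusDefined×PlusLe x∈S = S⇒PlusDefined x y x∈S , x∈S

  S-closed : ExcludedMiddle a → ∀ J → IsClosed (LatticeReduct A) (S A J)
  S-closed em J x x∉S with ¬⊆⇒∃∉ em x∉S
  ... | c , (u , v , u∈Ix , v∈J , c≤u⊕v) , c∉Ix =
    (u , false) ∷ (u ⊕ v , true) ∷ [] ,
    u∈Ix ∷ (λ u⊕v∈Ix → c∉Ix (downset c (u ⊕ v) c≤u⊕v u⊕v∈Ix)) ∷ [] ,
    λ { z (u∈Iz ∷ u⊕v∉Iz ∷ []) z∈S → u⊕v∉Iz (z∈S (u , v , u∈Iz , v∈J , ≤-refl (u ⊕ v))) }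
    where open IsPrimeLatticeIdeal (proj₂ x)

  module _ (y : Spectrum A) (y-prime : IsPrimeMVIdeal A (I y)) where
    open IsPrimeMVIdeal y-prime using (prime)

    S-prime-⊈⇒⊇ : ∀ x x′ → S A (I y) x → S A (I y) x′ →
                  ∀ {c} → c ∈ I x → ¬ c ∈ I x′ → x′ ≤ₚ x
    S-prime-⊈⇒⊇ x x′ x∈S x′∈S {c} c∈Ix c∉Ix′ {d} d∈Ix′ with prime c d
    ... | inj₁ c⊖d∈Iy = contradiction (x′∈S (d , c ⊖ d , d∈Ix′ , c⊖d∈Iy , x≤y⊕[x⊖y] c d)) c∉Ix′
    ... | inj₂ d⊖c∈Iy = x∈S (c , d ⊖ c , c∈Ix , d⊖c∈Iy , x≤y⊕[x⊖y] d c)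

    S-prime-total : ExcludedMiddle a → ∀ x x′ → S A (I y) x → S A (I y) x′ →
                    (x ≤ₚ x′) ⊎ (x′ ≤ₚ x)
    S-prime-total em x x′ x∈S x′∈S with em {x ≤ₚ x′}
    ... | yes x≤x′ = inj₁ x≤x′
    ... | no x≰x′ with ¬⊆⇒∃∉ em x≰x′
    ...   | c , c∈Ix , c∉Ix′ = inj₂ (S-prime-⊈⇒⊇ x x′ x∈S x′∈S c∈Ix c∉Ix′)

module QuotientSpectrum {a : Level} (A : MVAlgebra a)
                        {J : Pred (MVAlgebra.Carrier A) a} (J-ideal : IsMVIdeal A J) where
  open MVAlgebra A
  open MVProperties A
  open IsMVIdeal J-ideal using (𝟘∈) renaming (downset to J-downset)

  private
    L = LatticeReduct A
    Q = QuotientLattice A J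

  ≤⇒≤Q : ∀ x y → x ≤ y → LatticeData._≤_ Q x y
  ≤⇒≤Q x y x∨y≡y = subst J (sym (trans (cong (λ t → dist t y) x∨y≡y) (dist-self y))) 𝟘∈

  dist-x-[x⊕j]∈J : ∀ x j → j ∈ J → dist x (x ⊕ j) ∈ J
  dist-x-[x⊕j]∈J x j j∈J =
    subst J (sym (dist-x-[x⊕y] x j)) (J-downset _ j ([x⊕y]⊖x≤y x j) j∈J)

  module _ {P : Pred Carrier a} (isP : IsPrimeLatticeIdeal Q P) where
    open IsPrimeLatticeIdeal isP

    quotientIdeal⇒ideal : IsPrimeLatticeIdeal L P
    quotientIdeal⇒ideal = record
      { respects = λ x y x≡y → subst P x≡y
      ; ⊥∈       = ⊥∈
      ; downset  = λ x y x≤y → downset x y (≤⇒≤Q x y x≤y)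
      ; ∨-closed = ∨-closed
      ; proper   = proper
      ; prime    = prime
      }

    quotientIdeal-saturated : _⊕̄_ A P J ⊆ P
    quotientIdeal-saturated (x , j , x∈P , j∈J , c≤x⊕j) =
      downset _ (x ⊕ j) (≤⇒≤Q _ (x ⊕ j) c≤x⊕j)
        (respects x (x ⊕ j) (dist-x-[x⊕j]∈J x j j∈J) x∈P)

  module _ {P : Pred Carrier a} (isP : IsPrimeLatticeIdeal L P) (saturated : _⊕̄_ A P J ⊆ P) where
    open IsPrimeLatticeIdeal isP

    respects-θ : ∀ x y → dist x y ∈ J → x ∈ P → y ∈ P
    respects-θ x y d∈J x∈P = saturated (x , dist x y , x∈P , d∈J , y≤x⊕dist x y)

    saturated⇒quotientIdeal : IsPrimeLatticeIdeal Q P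
    saturated⇒quotientIdeal = record
      { respects = respects-θ
      ; ⊥∈       = ⊥∈
      ; downset  = λ x y d∈J y∈P →
          downset x (x ∨ y) (x≤x∨y x y)
            (respects-θ y (x ∨ y) (subst J (dist-comm (x ∨ y) y) d∈J) y∈P)
      ; ∨-closed = ∨-closed
      ; proper   = proper
      ; prime    = prime
      }

  toS : Point Q → SubPoint L (S A J)
  toS (P , isP) = (P , quotientIdeal⇒ideal isP) , quotientIdeal-saturated isP

  fromS : SubPoint L (S A J) → Point Q
  fromS ((P , isP) , saturated) = P , saturated⇒quotientIdeal isP saturated

  -- Subbasic sets only mention the ideal, which toS and fromS leave unchanged.
  Holds-Q⇒L : ∀ s {P} {isP : IsPrimeLatticeIdeal Q P} {isP′ : IsPrimeLatticeIdeal L P} →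
              Holds Q s (P , isP) → Holds L s (P , isP′)
  Holds-Q⇒L (d , true)  d∉P = d∉P
  Holds-Q⇒L (d , false) d∈P = d∈P

  Holds-L⇒Q : ∀ s {P} {isP : IsPrimeLatticeIdeal L P} {isP′ : IsPrimeLatticeIdeal Q P} →
              Holds L s (P , isP) → Holds Q s (P , isP′)
  Holds-L⇒Q (d , true)  d∉P = d∉P
  Holds-L⇒Q (d , false) d∈P = d∈P

  toS-continuous : ∀ (O : Pred (SubPoint L (S A J)) (lsuc a)) → IsOpenSub L (S A J) O → IsOpen Q (λ x → O (toS x))
  toS-continuous O (O′ , O′-open , O⇔O′) x x∈O
    with O′-open (proj₁ (toS x)) (proj₁ (O⇔O′ (toS x)) x∈O)
  ... | ds , x∈ds , ds⊆O′ =
    ds , All.map (λ {s} → Holds-L⇒Q s) x∈ds ,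
    λ z z∈ds → proj₂ (O⇔O′ (toS z)) (ds⊆O′ _ (All.map (λ {s} → Holds-Q⇒L s) z∈ds))

  fromS-continuous : ∀ (O : Pred (Point Q) (lsuc a)) → IsOpen Q O → IsOpenSub L (S A J) (λ p → O (fromS p))
  fromS-continuous O O-open = O′ , O′-open , λ p → O⇒O′ p , O′⇒O p
    where
    O′ : Pred (Point L) (lsuc a)
    O′ z = Σ (List (Carrier × _)) λ ds →
             All (λ s → Holds L s z) ds × (∀ w → All (λ s → Holds Q s w) ds → O w)

    O′-open : IsOpen L O′
    O′-open z (ds , z∈ds , ds⊆O) = ds , z∈ds , λ w w∈ds → ds , w∈ds , ds⊆O

    O⇒O′ : ∀ p → O (fromS p) → O′ (proj₁ p)
    O⇒O′ p fromp∈O with O-open (fromS p) fromp∈O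
    ... | ds , p∈ds , ds⊆O = ds , All.map (λ {s} → Holds-Q⇒L s) p∈ds , ds⊆O

    O′⇒O : ∀ p → O′ (proj₁ p) → O (fromS p)
    O′⇒O p (ds , p∈ds , ds⊆O) = ds⊆O (fromS p) (All.map (λ {s} → Holds-L⇒Q s) p∈ds)

  quotientSpectrum≅S : OrderHomeo Q L (S A J)
  quotientSpectrum≅S = record
    { to              = toS
    ; from            = fromS
    ; to-cong         = λ _ _ x≈y → x≈y
    ; from-cong       = λ _ _ p≈q → p≈q
    ; from-to         = λ _ → (λ c∈ → c∈) , (λ c∈ → c∈)
    ; to-from         = λ _ → (λ c∈ → c∈) , (λ c∈ → c∈)
    ; to-mono         = λ _ _ x≤y → x≤y
    ; to-reflect      = λ _ _ x≤y → x≤y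
    ; to-continuous   = toS-continuous
    ; from-continuous = fromS-continuous
    }

proposition7p1 : {a : Level} → ExcludedMiddle (lsuc a) →
    (A : MVAlgebra a) (J : Pred (MVAlgebra.Carrier A) a) → IsMVIdeal A J →
    OrderHomeo (QuotientLattice A J) (LatticeReduct A) (S A J)
    × IsClosed (LatticeReduct A) (S A J)
    × ((y : Spectrum A) → IsPrimeMVIdeal A (I y) →
         ((x : Spectrum A) → S A (I y) x ⇔ (PlusDefined A x y × PlusLe A x y))
         × ((x x′ : Spectrum A) → S A (I y) x → S A (I y) x′ → (x ≤ₚ x′) ⊎ (x′ ≤ₚ x)))
proposition7p1 em A J J-ideal =
  QuotientSpectrum.quotientSpectrum≅S A J-ideal ,
  S-closed em′ J ,
  λ y y-prime →
    (λ x → S⇔PlusDefined×PlusLe x y) ,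
    S-prime-total y y-prime em′
  where
  open SpectrumProperties A
  em′ = lowerExcludedMiddle em
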